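{- Let $\mathcal{M},\mathcal{N}$ be models and $\{\leftrightarrows_a\}_{a\in A\cup\{alt\}}$ an agent-alternating bisimulation family between them. For every $a\in A$, if $u\leftrightarrows_a v$ then $\mathcal{M},u\equiv_{\mathcal{L}_{ -a}}\mathcal{N},v$; and if $u\leftrightarrows_{alt}v$ then $\mathcal{M},u\equiv_{\mathcal{L}_{alt}}\mathcal{N},v$.
   Context: Fix a set $A$ of agents with $|A|\ge 2$, a countably infinite set $\mathsf{Prop}$ of proposition letters, and an object $alt\notin A$. The language $\mathcal{L}$ is given by $\varphi::=p\mid\neg\varphi\mid(\varphi\wedge\varphi)\mid\Box_a\varphi$ ($p\in\mathsf{Prop}$, $a\in A$). A model $\mathcal{M}=\langle W^{\mathcal{M}},\{R^{\mathcal{M}}_a\}_{a\in A},V^{\mathcal{M}}\rangle$ has a nonempty set of worlds, binary relations $R^{\mathcal{M}}_a$ and valuation $V^{\mathcal{M}}:\mathsf{Prop}\to\wp(W^{\mathcal{M}})$, with standard Kripke semantics. For a set $\mathcal{L}'$ of formulas, $\mathcal{M},u\equiv_{\mathcal{L}'}\mathcal{N},v$ means: for all $\varphi\in\mathcal{L}'$, $\mathcal{M},u\models\varphi$ iff $\mathcal{N},v\models\varphi$. The fragments $\mathcal{L}_{ -a}$ ($a\in A$) are defined by simultaneous induction: $\mathcal{L}_{ -a}$ is the least set containing every $p\in\mathsf{Prop}$, every $\Box_x\psi$ with $x\in A\setminus\{a\}$ and $\psi\in\mathcal{L}_{ -x}$, and closed under $\neg,\wedge$; $\mathcal{L}_{alt}$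 is the least set containing $\mathsf{Prop}\cup\bigcup_{a\in A}\mathcal{L}_{ -a}$ closed under $\neg,\wedge$. An agent-alternating bisimulation family between $\mathcal{M}$ and $\mathcal{N}$ is a family $\{\leftrightarrows_a\}_{a\in A\cup\{alt\}}$ of relations between $W^{\mathcal{M}}$ and $W^{\mathcal{N}}$ such that for every $a\in A\cup\{alt\}$ and $u\leftrightarrows_a v$: (Atom) $u\in V^{\mathcal{M}}(p)$ iff $v\in V^{\mathcal{N}}(p)$ for all $p$; (Zig) for all $b\in A\setminus\{a\}$ and $u'\in R^{\mathcal{M}}_b(u)$ there is $v'\in R^{\mathcal{N}}_b(v)$ with $u'\leftrightarrows_b v'$; (Zag) for all $b\in A\setminus\{a\}$ and $v'\in R^{\mathcal{N}}_b(v)$ there is $u'\in R^{\mathcal{M}}_b(u)$ with $u'\leftrightarrows_b v'$. (For $a=alt$, $A\setminus\{alt\}=A$.) -}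

module Defs where

open import Data.Nat using (ℕ)
open import Data.Empty using (⊥)
open import Data.Product using (Σ; _×_; ∃; _,_)
open import Relation.Nullary using (¬_)
open import Relation.Binary.PropositionalEquality using (_≡_)
open import Function.Bundles using (_⇔_)

data Form (Ag : Set) : Set where
  var : ℕ → Form Ag
  ¬ᶠ_ : Form Ag → Form Ag
  _∧ᶠ_ : Form Ag → Form Ag → Form Ag
  □ : Ag → Form Ag → Form Ag

record Model (Ag : Set) : Set₁ where
  field
    W : Set
    nonempty : W
    R : Ag → W → W → Set
    V : ℕ → W → Set

open Model public

_,_⊨_ : {Ag : Set} (M : Model Ag) → W M → Form Ag → Set
M , u ⊨ var p = V M p u
M , u ⊨ (¬ᶠ φ) = ¬ (M , u ⊨ φ)
M , u ⊨ (φ ∧ᶠ ψ) = (M , u ⊨ φ) × (M , u ⊨ ψ)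
M , u ⊨ □ a φ = ∀ u' → R M a u u' → M , u' ⊨ φ

data InMinus {Ag : Set} (a : Ag) : Form Ag → Set where
  var : ∀ p → InMinus a (var p)
  box : ∀ x ψ → ¬ (x ≡ a) → InMinus x ψ → InMinus a (□ x ψ)
  neg : ∀ φ → InMinus a φ → InMinus a (¬ᶠ φ)
  conj : ∀ φ ψ → InMinus a φ → InMinus a ψ → InMinus a (φ ∧ᶠ ψ)

data InAlt {Ag : Set} : Form Ag → Set where
  var : ∀ p → InAlt (var p)
  minus : ∀ a φ → InMinus a φ → InAlt φ
  neg : ∀ φ → InAlt φ → InAlt (¬ᶠ φ)
  conj : ∀ φ ψ → InAlt φ → InAlt ψ → InAlt (φ ∧ᶠ ψ)

data Idx (Ag : Set) : Set where
  ag : Ag → Idx Ag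
  alt : Idx Ag

-- b ∈ A \ {i}  (for i = alt this is all of A)
NotIdx : {Ag : Set} → Ag → Idx Ag → Set
NotIdx b (ag a) = ¬ (b ≡ a)
NotIdx b alt = Data.Unit.⊤
  where import Data.Unit

Equiv : {Ag : Set} (P : Form Ag → Set) (M N : Model Ag) → W M → W N → Set
Equiv P M N u v = ∀ φ → P φ → (M , u ⊨ φ) ⇔ (N , v ⊨ φ)

record IsAltBisimFamily {Ag : Set} (M N : Model Ag)
    (Z : Idx Ag → W M → W N → Set) : Set where
  field
    atom : ∀ i u v → Z i u v → ∀ p → (V M p u ⇔ V N p v)
    zig : ∀ i u v → Z i u v → ∀ b → NotIdx b i →
          ∀ u' → R M b u u' → ∃ λ v' → R N b v v' × Z (ag b) u' v'
    zag : ∀ i u v → Z i u v → ∀ b → NotIdx b i →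
          ∀ v' → R N b v v' → ∃ λ u' → R M b u u' × Z (ag b) u' v'

module Submission where

open import Defs
open import Data.Product using (_×_; ∃; _,_)
open import Data.Product.Function.NonDependent.Propositional using (_×-⇔_)
open import Data.Unit using (tt)
open import Function.Bundles using (_⇔_; mk⇔; module Equivalence)
open import Function.Related.TypeIsomorphisms using (¬-cong-⇔)
open import Relation.Nullary using (¬_)
open import Relation.Binary.PropositionalEquality using (_≡_)

-- A boxed subformula □ₓ ψ of φ has
-- x ≠ a and ψ ∈ L₋ₓ, so zig/zag link the x-successors by ↔ₓ, which is the
-- relation the induction hypothesis needs for L₋ₓ. The link u ↔ᵢ v need
-- not be indexed by a: it suffices that zig/zag for ↔ᵢ apply to every agent
-- b ≠ a (Covers i a), which is why ↔ₐₗₜ handles every L₋ₐ at once.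

Covers : {Ag : Set} → Idx Ag → Ag → Set
Covers i a = ∀ b → ¬ b ≡ a → NotIdx b i

ag-covers : {Ag : Set} (a : Ag) → Covers (ag a) a
ag-covers a b b≢a = b≢a

alt-covers : {Ag : Set} (a : Ag) → Covers alt a
alt-covers a b b≢a = tt

module _ {Ag : Set} (M N : Model Ag) (Z : Idx Ag → W M → W N → Set)
         (B : IsAltBisimFamily M N Z) where
  open IsAltBisimFamily B
  open Equivalence

  minus-invariant : ∀ i a → Covers i a → ∀ u v → Z i u v →
                    Equiv (InMinus a) M N u v
  minus-invariant i a i⊒a u v z .(var p) (var p) = atom i u v z p
  minus-invariant i a i⊒a u v z .(¬ᶠ φ) (neg φ φ∈) =
    ¬-cong-⇔ (minus-invariant i a i⊒a u v z φ φ∈)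
  minus-invariant i a i⊒a u v z .(φ ∧ᶠ ψ) (conj φ ψ φ∈ ψ∈) =
    minus-invariant i a i⊒a u v z φ φ∈ ×-⇔ minus-invariant i a i⊒a u v z ψ ψ∈
  minus-invariant i a i⊒a u v z .(□ x ψ) (box x ψ x≢a ψ∈) = mk⇔ forth back
    where
    successor : ∀ u' v' → Z (ag x) u' v' → (M , u' ⊨ ψ) ⇔ (N , v' ⊨ ψ)
    successor u' v' z' = minus-invariant (ag x) x (ag-covers x) u' v' z' ψ ψ∈

    forth : M , u ⊨ □ x ψ → N , v ⊨ □ x ψ
    forth □ψ v' v→v' with zag i u v z x (i⊒a x x≢a) v' v→v'
    ... | u' , u→u' , z' = to (successor u' v' z') (□ψ u' u→u')

    back : N , v ⊨ □ x ψ → M , u ⊨ □ x ψ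
    back □ψ u' u→u' with zig i u v z x (i⊒a x x≢a) u' u→u'
    ... | v' , v→v' , z' = from (successor u' v' z') (□ψ v' v→v')

  alt-invariant : ∀ u v → Z alt u v → Equiv InAlt M N u v
  alt-invariant u v z .(var p) (var p) = atom alt u v z p
  alt-invariant u v z φ (minus a .φ φ∈) =
    minus-invariant alt a (alt-covers a) u v z φ φ∈
  alt-invariant u v z .(¬ᶠ φ) (neg φ φ∈) = ¬-cong-⇔ (alt-invariant u v z φ φ∈)
  alt-invariant u v z .(φ ∧ᶠ ψ) (conj φ ψ φ∈ ψ∈) =
    alt-invariant u v z φ φ∈ ×-⇔ alt-invariant u v z ψ ψ∈

mainTheorem7 : {Ag : Set} → (∃ λ (a₁ : Ag) → ∃ λ (a₂ : Ag) → ¬ (a₁ ≡ a₂)) →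
    (M N : Model Ag) (Z : Idx Ag → W M → W N → Set) →
    IsAltBisimFamily M N Z →
    ((a : Ag) (u : W M) (v : W N) → Z (ag a) u v → Equiv (InMinus a) M N u v)
    × ((u : W M) (v : W N) → Z alt u v → Equiv InAlt M N u v)
mainTheorem7 _ M N Z B =
  (λ a → minus-invariant M N Z B (ag a) a (ag-covers a)) ,
  alt-invariant M N Z B
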